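{- Let $G=(V,E)$ be a finite graph and $k$ a positive integer. Let $\mathcal F=\{\{(A_1,B_1),(A_2,B_2),(A_3,B_3)\}\subseteq\vec S_k: G[A_1]\cup G[A_2]\cup G[A_3]=G\}$ (the three separations need not be distinct), and let $\mathcal F^*$ be the set of those elements of $\mathcal F$ that are stars. Then every consistent orientation of $S_k$ that avoids $\mathcal F^*$ also avoids $\mathcal F$.
   Context: A (vertex) separation of $G$ is an ordered pair $(A,B)$ with $A\cup B=V$ such that $G$ has no edge between $A\setminus B$ and $B\setminus A$; its inverse is $(B,A)$, and the unoriented separation is $\{A,B\}$. These are partially ordered by $(A,B)\le(C,D)$ iff $A\subseteq C$ and $B\supseteq D$. $\vec S_k$ is the set of separations $(A,B)$ with $|A\cap B|<k$ and $S_k$ the set of corresponding $\{A,B\}$. A star is a nonempty set $\sigma$ of oriented separations with $\vec r\le\overleftarrow s$ for all distinct $\vec r,\vec s\in\sigma$ (where $\overleftarrow s$ is the inverse of $\vec s$). An orientation of $S_k$ is a subset of $\vec S_k$ containing exactly one of $(A,B),(B,A)$ for each $\{A,B\}\in S_k$. It is consistent if there are no distinct $r,s$ with orientations $\vec r<\vec s$ such that $\overleftarrow r$ and $\vec s$ both lie in it. It avoids a family $\mathcal F$ if none of its subsets lies in $\mathcal F$. -}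

module Defs where

open import Data.Nat using (ℕ; _<_; _≥_)
open import Data.Fin using (Fin)
open import Data.Fin.Subset using (Subset; _∈_; _∉_; _⊆_; _∩_; ∣_∣)
open import Data.Product using (_×_; _,_; proj₁; proj₂)
open import Data.Sum using (_⊎_)
open import Data.Empty using (⊥)
open import Relation.Nullary using (¬_)
open import Relation.Binary.PropositionalEquality using (_≡_; _≢_)

record Graph (n : ℕ) : Set₁ where
  field
    Adj   : Fin n → Fin n → Set
    sym   : ∀ {u v} → Adj u v → Adj v u
    irrfl : ∀ {u} → ¬ Adj u u
open Graph public

OSep : ℕ → Set
OSep n = Subset n × Subset n

inv : ∀ {n} → OSep n → OSep n
inv (A , B) = (B , A)

IsSep : ∀ {n} → Graph n → OSep n → Set
IsSep {n} G (A , B) =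
  (∀ (v : Fin n) → v ∈ A ⊎ v ∈ B) ×
  (∀ (u v : Fin n) → Adj G u v → u ∈ A → u ∉ B → v ∈ B → v ∉ A → ⊥)

InSk : ∀ {n} → Graph n → ℕ → OSep n → Set
InSk G k (A , B) = IsSep G (A , B) × ∣ A ∩ B ∣ < k

_≤s_ : ∀ {n} → OSep n → OSep n → Set
(A , B) ≤s (C , D) = A ⊆ C × D ⊆ B

_<s_ : ∀ {n} → OSep n → OSep n → Set
r <s s = r ≤s s × r ≢ s

SameUnoriented : ∀ {n} → OSep n → OSep n → Set
SameUnoriented r s = r ≡ s ⊎ r ≡ inv s

IsOrientation : ∀ {n} → Graph n → ℕ → (OSep n → Set) → Set
IsOrientation {n} G k O =
  (∀ s → O s → InSk G k s) ×
  (∀ s → InSk G k s → O s ⊎ O (inv s)) ×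
  (∀ s → InSk G k s → s ≢ inv s → ¬ (O s × O (inv s)))

IsConsistent : ∀ {n} → Graph n → ℕ → (OSep n → Set) → Set
IsConsistent G k O =
  ∀ r s → InSk G k r → InSk G k s → ¬ SameUnoriented r s →
    r <s s → O (inv r) → O s → ⊥

_∈₃_ : ∀ {n} → OSep n → OSep n × OSep n × OSep n → Set
r ∈₃ (s₁ , s₂ , s₃) = r ≡ s₁ ⊎ r ≡ s₂ ⊎ r ≡ s₃

IsStar₃ : ∀ {n} → OSep n × OSep n × OSep n → Set
IsStar₃ σ = ∀ r s → r ∈₃ σ → s ∈₃ σ → r ≢ s → r ≤s inv s

Covers : ∀ {n} → Graph n → OSep n × OSep n × OSep n → Set
Covers {n} G ((A₁ , _) , (A₂ , _) , (A₃ , _)) =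
  (∀ (v : Fin n) → v ∈ A₁ ⊎ v ∈ A₂ ⊎ v ∈ A₃) ×
  (∀ (u v : Fin n) → Adj G u v →
     (u ∈ A₁ × v ∈ A₁) ⊎ (u ∈ A₂ × v ∈ A₂) ⊎ (u ∈ A₃ × v ∈ A₃))

InF : ∀ {n} → Graph n → ℕ → OSep n × OSep n × OSep n → Set
InF G k (s₁ , s₂ , s₃) =
  (InSk G k s₁ × InSk G k s₂ × InSk G k s₃) × Covers G (s₁ , s₂ , s₃)

InFstar : ∀ {n} → Graph n → ℕ → OSep n × OSep n × OSep n → Set
InFstar G k σ = InF G k σ × IsStar₃ σ

Avoids : ∀ {n} → (OSep n → Set) → (OSep n × OSep n × OSep n → Set) → Set
Avoids O 𝓕 = ∀ s₁ s₂ s₃ → O s₁ → O s₂ → O s₃ → ¬ 𝓕 (s₁ , s₂ , s₃)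

module Submission where

-- Take a triple (s₁,s₂,s₃) ⊆ O with G[A₁] ∪ G[A₂] ∪ G[A₃] = G and minimal
-- weight μ(A,B) = |A| + |V∖B| summed over the triple.  If every two of its
-- members are equal or nested (s ≤ t⃖) it is a star, contradicting the
-- hypothesis.  Otherwise some pair s = (A,B), t = (C,D) is not nested.  By
-- submodularity of the order, one of the corners s ∧ t⃖ = (A∩D, B∪C) or
-- t ∧ s⃖ lies in S_k; say the first.  It is a separation below s, it still
-- covers G together with the other two members, it has smaller weight, and
-- consistency puts it into O (it cannot be the inverse of s, for then A = V
-- and (s,s,s) would be a covering star).  This contradicts minimality.

open import Defs
open import Data.Bool using (Bool; true; false; _∧_; _∨_)
import Data.Bool.Properties as Bool
open import Data.Empty using (⊥; ⊥-elim)
open import Data.Fin.Properties using (¬∀⟶∃¬)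
open import Data.Fin.Subset using (Subset; _∈_; _∉_; _⊆_; _∩_; _∪_; ∁; ∣_∣)
open import Data.Fin.Subset.Properties
  using (_∈?_; _⊆?_; p⊆q⇒∣p∣≤∣q∣; p⊂q⇒∣p∣<∣q∣; p⊂q⇒∁p⊃∁q; p⊆q⇒∁p⊇∁q; ∣p∩q∣≤∣p∣;
         p∩q⊆p; p∩q⊆q; x∈p∩q⁺; x∈p∪q⁺; p⊆p∪q)
open import Data.Nat using (ℕ; _≤_; _<_; _≥_; _+_; _≤?_)
open import Data.Nat.Induction using (<-wellFounded)
open import Data.Nat.Properties
  using (≤-<-trans; +-mono-≤; +-monoˡ-≤; +-monoˡ-<; +-mono-<; +-mono-<-≤; +-mono-≤-<;
         +-cancelˡ-<; ≰⇒>; <-irrefl; +-commutativeSemigroup)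
open import Algebra.Properties.CommutativeSemigroup +-commutativeSemigroup
  using (interchange; x∙yz≈y∙xz; x∙yz≈x∙zy)
open import Data.Product using (_×_; _,_; proj₁; proj₂; ∃-syntax)
import Data.Product.Properties as Product
open import Data.Sum using (_⊎_; inj₁; inj₂; [_,_]; map₂; swap)
open import Data.Vec using (_∷_; [])
import Data.Vec.Properties as Vec
open import Function using (_∘_)
open import Induction.WellFounded using (Acc; acc)
open import Relation.Binary.PropositionalEquality using (_≡_; _≢_; refl; cong; subst)
  renaming (sym to ≡-sym)
open import Relation.Nullary using (¬_; Dec; yes; no)
open import Relation.Nullary.Decidable using (toWitness; True; map′; _×-dec_; _→-dec_)

private
  variable
    n : ℕ

-- A failed inclusion has a constructive witness, since membership is decidable.
⊈-witness : {p q : Subset n} → ¬ (p ⊆ q) → ∃[ x ] (x ∈ p × x ∉ q)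
⊈-witness {n} {p} {q} p⊈q with ¬∀⟶∃¬ n (λ x → x ∈ p → x ∈ q) (λ x → x ∈? p →-dec x ∈? q)
                                     (λ p⊆q → p⊈q (p⊆q _))
... | x , ¬[x∈p→x∈q] with x ∈? p
...   | yes x∈p = x , x∈p , λ x∈q → ¬[x∈p→x∈q] (λ _ → x∈q)
...   | no  x∉p = ⊥-elim (¬[x∈p→x∈q] (⊥-elim ∘ x∉p))

∣p∩q∣<∣p∣ : (p q : Subset n) → ¬ (p ⊆ q) → ∣ p ∩ q ∣ < ∣ p ∣
∣p∩q∣<∣p∣ p q p⊈q with ⊈-witness p⊈q
... | x , x∈p , x∉q = p⊂q⇒∣p∣<∣q∣ (p∩q⊆p p q , x , x∈p , x∉q ∘ p∩q⊆q p q)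

∣∁p∪q∣≤∣∁p∣ : (p q : Subset n) → ∣ ∁ (p ∪ q) ∣ ≤ ∣ ∁ p ∣
∣∁p∪q∣≤∣∁p∣ p q = p⊆q⇒∣p∣≤∣q∣ (p⊆q⇒∁p⊇∁q {p = p} (p⊆p∪q q))

∣∁p∪q∣<∣∁p∣ : (p q : Subset n) → ¬ (q ⊆ p) → ∣ ∁ (p ∪ q) ∣ < ∣ ∁ p ∣
∣∁p∪q∣<∣∁p∣ p q q⊈p with ⊈-witness q⊈p
... | x , x∈q , x∉p = p⊂q⇒∣p∣<∣q∣ (p⊂q⇒∁p⊃∁q (p⊆p∪q q , x , x∈p∪q⁺ (inj₂ x∈q) , x∉p))

bit : Bool → ℕ
bit true  = 1
bit false = 0

∣b∷p∣ : (b : Bool) (p : Subset n) → ∣ b ∷ p ∣ ≡ bit b + ∣ p ∣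
∣b∷p∣ true  p = refl
∣b∷p∣ false p = refl

by-computation : {m n : ℕ} → {True (m ≤? n)} → m ≤ n
by-computation {_} {_} {m≤n} = toWitness m≤n

-- Submodularity of the order of separations, one vertex at a time: the two
-- corner separators (A₁∩B₂)∩(B₁∪A₂) and (A₂∩B₁)∩(B₂∪A₁) contain a vertex at
-- most as often as the separators A₁∩B₁ and A₂∩B₂ together.
corner-submodular-bit : (a₁ b₁ a₂ b₂ : Bool) →
  bit ((a₁ ∧ b₂) ∧ (b₁ ∨ a₂)) + bit ((a₂ ∧ b₁) ∧ (b₂ ∨ a₁)) ≤ bit (a₁ ∧ b₁) + bit (a₂ ∧ b₂)
corner-submodular-bit true  true  true  true  = by-computation
corner-submodular-bit true  true  true  false = by-computation
corner-submodular-bit true  true  false true  = by-computation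
corner-submodular-bit true  true  false false = by-computation
corner-submodular-bit true  false true  true  = by-computation
corner-submodular-bit true  false true  false = by-computation
corner-submodular-bit true  false false true  = by-computation
corner-submodular-bit true  false false false = by-computation
corner-submodular-bit false true  true  true  = by-computation
corner-submodular-bit false true  true  false = by-computation
corner-submodular-bit false true  false true  = by-computation
corner-submodular-bit false true  false false = by-computation
corner-submodular-bit false false true  true  = by-computation
corner-submodular-bit false false true  false = by-computation
corner-submodular-bit false false false true  = by-computation
corner-submodular-bit false false false false = by-computation

corner-submodular : (A₁ B₁ A₂ B₂ : Subset n) →
  ∣ (A₁ ∩ B₂) ∩ (B₁ ∪ A₂) ∣ + ∣ (A₂ ∩ B₁) ∩ (B₂ ∪ A₁) ∣ ≤ ∣ A₁ ∩ B₁ ∣ + ∣ A₂ ∩ B₂ ∣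
corner-submodular [] [] [] [] = by-computation
corner-submodular (a₁ ∷ A₁) (b₁ ∷ B₁) (a₂ ∷ A₂) (b₂ ∷ B₂)
  rewrite ∣b∷p∣ ((a₁ ∧ b₂) ∧ (b₁ ∨ a₂)) ((A₁ ∩ B₂) ∩ (B₁ ∪ A₂))
        | ∣b∷p∣ ((a₂ ∧ b₁) ∧ (b₂ ∨ a₁)) ((A₂ ∩ B₁) ∩ (B₂ ∪ A₁))
        | ∣b∷p∣ (a₁ ∧ b₁) (A₁ ∩ B₁)
        | ∣b∷p∣ (a₂ ∧ b₂) (A₂ ∩ B₂)
        | interchange (bit ((a₁ ∧ b₂) ∧ (b₁ ∨ a₂))) (∣ (A₁ ∩ B₂) ∩ (B₁ ∪ A₂) ∣)
                      (bit ((a₂ ∧ b₁) ∧ (b₂ ∨ a₁))) (∣ (A₂ ∩ B₁) ∩ (B₂ ∪ A₁) ∣)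
        | interchange (bit (a₁ ∧ b₁)) (∣ A₁ ∩ B₁ ∣) (bit (a₂ ∧ b₂)) (∣ A₂ ∩ B₂ ∣)
  = +-mono-≤ (corner-submodular-bit a₁ b₁ a₂ b₂) (corner-submodular A₁ B₁ A₂ B₂)

-- The corner s ∧ t⃖ = (A∩D, B∪C) of s = (A,B) and t = (C,D); its separator is
-- (A∩D) ∩ (B∪C).
corner : OSep n → OSep n → OSep n
corner (A , B) (C , D) = (A ∩ D , B ∪ C)

corner-≤ : (s t : OSep n) → corner s t ≤s s
corner-≤ (A , B) (C , D) = p∩q⊆p A D , p⊆p∪q C

order : OSep n → ℕ
order (A , B) = ∣ A ∩ B ∣

corner-order< : ∀ {k} (s t : OSep n) → order s < k → order t < k →
  order (corner s t) < k ⊎ order (corner t s) < k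
corner-order< {k = k} s@(A , B) t@(C , D) s<k t<k with k ≤? order (corner s t)
... | no  k≰st = inj₁ (≰⇒> k≰st)
... | yes k≤st = inj₂ (+-cancelˡ-< k _ _ (≤-<-trans (+-monoˡ-≤ (order (corner t s)) k≤st)
                         (≤-<-trans (corner-submodular A B C D) (+-mono-< s<k t<k))))

-- The weight |A| + |V∖B| of a separation; it strictly decreases along < .
weight : OSep n → ℕ
weight (A , B) = ∣ A ∣ + ∣ ∁ B ∣

corner-lighter : (s t : OSep n) → ¬ (s ≤s inv t) → weight (corner s t) < weight s
corner-lighter (A , B) (C , D) s≰t⃖ with A ⊆? D
... | no  A⊈D = +-mono-<-≤ (∣p∩q∣<∣p∣ A D A⊈D) (∣∁p∪q∣≤∣∁p∣ B C)
... | yes A⊆D = +-mono-≤-< (∣p∩q∣≤∣p∣ A D) (∣∁p∪q∣<∣∁p∣ B C (λ C⊆B → s≰t⃖ (A⊆D , C⊆B)))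

module _ (G : Graph n) where

  ∉B⇒∈A : ∀ {A B} → IsSep G (A , B) → ∀ {v} → v ∉ B → v ∈ A
  ∉B⇒∈A (covers , _) {v} v∉B = [ (λ v∈A → v∈A) , ⊥-elim ∘ v∉B ] (covers v)

  ∉A⇒∈B : ∀ {A B} → IsSep G (A , B) → ∀ {v} → v ∉ A → v ∈ B
  ∉A⇒∈B (covers , _) {v} v∉A = [ ⊥-elim ∘ v∉A , (λ v∈B → v∈B) ] (covers v)

  neighbour-∈A : ∀ {A B} → IsSep G (A , B) → ∀ {u v} → Adj G u v → u ∉ B → v ∈ A
  neighbour-∈A {A} sep {u} {v} uv u∉B with v ∈? A
  ... | yes v∈A = v∈A
  ... | no  v∉A = ⊥-elim (proj₂ sep u v uv (∉B⇒∈A sep u∉B) u∉B (∉A⇒∈B sep v∉A) v∉A)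

  corner-isSep : (s t : OSep n) → IsSep G s → IsSep G t → IsSep G (corner s t)
  corner-isSep (A , B) (C , D) sepₛ sepₜ = covers , no-edge
    where
    covers : ∀ v → v ∈ A ∩ D ⊎ v ∈ B ∪ C
    covers v with v ∈? A | v ∈? D
    ... | yes v∈A | yes v∈D = inj₁ (x∈p∩q⁺ (v∈A , v∈D))
    ... | no  v∉A | _       = inj₂ (x∈p∪q⁺ (inj₁ (∉A⇒∈B sepₛ v∉A)))
    ... | yes _   | no  v∉D = inj₂ (x∈p∪q⁺ (inj₂ (∉B⇒∈A sepₜ v∉D)))
    no-edge : ∀ u v → Adj G u v → u ∈ A ∩ D → u ∉ B ∪ C → v ∈ B ∪ C → v ∉ A ∩ D → ⊥
    no-edge u v uv _ u∉B∪C _ v∉A∩D with v ∈? A | v ∈? D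
    ... | no  v∉A | _       = v∉A (neighbour-∈A sepₛ uv (u∉B∪C ∘ x∈p∪q⁺ ∘ inj₁))
    ... | yes v∈A | yes v∈D = v∉A∩D (x∈p∩q⁺ (v∈A , v∈D))
    ... | yes _   | no  v∉D = u∉B∪C (x∈p∪q⁺ (inj₂ (neighbour-∈A sepₜ (sym G uv) v∉D)))

  -- Replacing s₁ by its corner with s₂ keeps a covering triple covering: the
  -- part of G[A₁] outside D₂ lies in G[C₂].
  corner-covers : (s₁ s₂ s₃ : OSep n) → IsSep G s₂ →
    Covers G (s₁ , s₂ , s₃) → Covers G (corner s₁ s₂ , s₂ , s₃)
  corner-covers (A , B) (C , D) (E , F) sep (covers , edges) = covers′ , edges′
    where
    covers′ : ∀ v → v ∈ A ∩ D ⊎ v ∈ C ⊎ v ∈ E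
    covers′ v with covers v
    ... | inj₂ v∈C⊎E = inj₂ v∈C⊎E
    ... | inj₁ v∈A with v ∈? D
    ...   | yes v∈D = inj₁ (x∈p∩q⁺ (v∈A , v∈D))
    ...   | no  v∉D = inj₂ (inj₁ (∉B⇒∈A sep v∉D))
    edges′ : ∀ u v → Adj G u v →
      (u ∈ A ∩ D × v ∈ A ∩ D) ⊎ (u ∈ C × v ∈ C) ⊎ (u ∈ E × v ∈ E)
    edges′ u v uv with edges u v uv
    ... | inj₂ in-C⊎E = inj₂ in-C⊎E
    ... | inj₁ (u∈A , v∈A) with u ∈? D | v ∈? D
    ...   | yes u∈D | yes v∈D = inj₁ (x∈p∩q⁺ (u∈A , u∈D) , x∈p∩q⁺ (v∈A , v∈D))
    ...   | no  u∉D | _       = inj₂ (inj₁ (∉B⇒∈A sep u∉D , neighbour-∈A sep uv u∉D))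
    ...   | yes _   | no  v∉D = inj₂ (inj₁ (neighbour-∈A sep (sym G uv) v∉D , ∉B⇒∈A sep v∉D))

  -- If the corner s ∧ t⃖ equals s⃖ then B ⊆ A, so the small side of s is all of V.
  corner≡inv⇒full : (s t : OSep n) → IsSep G s → corner s t ≡ inv s → ∀ v → v ∈ proj₁ s
  corner≡inv⇒full (A , B) (C , D) sep A∩D,B∪C≡B,A v =
    [ (λ v∈A → v∈A) , (λ v∈B → p∩q⊆p A D (subst (v ∈_) (≡-sym A∩D≡B) v∈B)) ] (proj₁ sep v)
    where
    A∩D≡B : A ∩ D ≡ B
    A∩D≡B = cong proj₁ A∩D,B∪C≡B,A

  Covers-swap₁₂ : (s₁ s₂ s₃ : OSep n) → Covers G (s₁ , s₂ , s₃) → Covers G (s₂ , s₁ , s₃)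
  Covers-swap₁₂ _ _ _ (covers , edges) = ⊎-swap₁₂ ∘ covers , λ u v → ⊎-swap₁₂ ∘ edges u v
    where
    ⊎-swap₁₂ : ∀ {P Q R : Set} → P ⊎ Q ⊎ R → Q ⊎ P ⊎ R
    ⊎-swap₁₂ = [ inj₂ ∘ inj₁ , [ inj₁ , inj₂ ∘ inj₂ ] ]

  Covers-swap₂₃ : (s₁ s₂ s₃ : OSep n) → Covers G (s₁ , s₂ , s₃) → Covers G (s₁ , s₃ , s₂)
  Covers-swap₂₃ _ _ _ (covers , edges) = map₂ swap ∘ covers , λ u v → map₂ swap ∘ edges u v

-- Nested separations: s and t are equal or s ≤ t⃖.  A set of separations is a
-- star exactly when its members are pairwise nested.
Nested : OSep n → OSep n → Set
Nested s t = s ≢ t → s ≤s inv t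

nested? : (s t : OSep n) → Dec (Nested s t)
nested? s@(A , B) t@(C , D) with ≡-dec s t
  where ≡-dec = Product.≡-dec (Vec.≡-dec Bool._≟_) (Vec.≡-dec Bool._≟_)
... | yes s≡t = yes (λ s≢t → ⊥-elim (s≢t s≡t))
... | no  s≢t = map′ (λ s≤t⃖ _ → s≤t⃖) (λ nested → nested s≢t) ((A ⊆? D) ×-dec (C ⊆? B))

nested-refl : (s : OSep n) → Nested s s
nested-refl s s≢s = ⊥-elim (s≢s refl)

≤inv-sym : (s t : OSep n) → s ≤s inv t → t ≤s inv s
≤inv-sym _ _ (A⊆D , C⊆B) = C⊆B , A⊆D

nested-sym : (s t : OSep n) → Nested s t → Nested t s
nested-sym s t nested t≢s = ≤inv-sym s t (nested (t≢s ∘ ≡-sym))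

pairwise-nested⇒star : (s₁ s₂ s₃ : OSep n) →
  Nested s₁ s₂ → Nested s₁ s₃ → Nested s₂ s₃ → IsStar₃ (s₁ , s₂ , s₃)
pairwise-nested⇒star s₁ s₂ s₃ n₁₂ n₁₃ n₂₃ = star
  where
  star : ∀ r t → r ∈₃ (s₁ , s₂ , s₃) → t ∈₃ (s₁ , s₂ , s₃) → Nested r t
  star _ _ (inj₁ refl)        (inj₁ refl)        = nested-refl s₁
  star _ _ (inj₁ refl)        (inj₂ (inj₁ refl)) = n₁₂
  star _ _ (inj₁ refl)        (inj₂ (inj₂ refl)) = n₁₃
  star _ _ (inj₂ (inj₁ refl)) (inj₁ refl)        = nested-sym s₁ s₂ n₁₂
  star _ _ (inj₂ (inj₁ refl)) (inj₂ (inj₁ refl)) = nested-refl s₂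
  star _ _ (inj₂ (inj₁ refl)) (inj₂ (inj₂ refl)) = n₂₃
  star _ _ (inj₂ (inj₂ refl)) (inj₁ refl)        = nested-sym s₁ s₃ n₁₃
  star _ _ (inj₂ (inj₂ refl)) (inj₂ (inj₁ refl)) = nested-sym s₂ s₃ n₂₃
  star _ _ (inj₂ (inj₂ refl)) (inj₂ (inj₂ refl)) = nested-refl s₃

Triple : ℕ → Set
Triple n = OSep n × OSep n × OSep n

weight₃ : Triple n → ℕ
weight₃ (s₁ , s₂ , s₃) = weight s₁ + (weight s₂ + weight s₃)

module Descent (G : Graph n) (k : ℕ) (O : OSep n → Set)
  (orientation : IsOrientation G k O) (consistent : IsConsistent G k O)
  (avoids : Avoids O (InFstar G k)) where

  down-closed : ∀ {r s} → InSk G k r → O s → r ≤s s → r ≢ s → r ≢ inv s → O r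
  down-closed {r} {s} r∈Sk Os r≤s r≢s r≢s⃖ with proj₁ (proj₂ orientation) r r∈Sk
  ... | inj₁ Or  = Or
  ... | inj₂ Or⃖ =
    ⊥-elim (consistent r s r∈Sk (proj₁ orientation s Os) [ r≢s , r≢s⃖ ] (r≤s , r≢s) Or⃖ Os)

  -- No member of O has small side V, for then (s,s,s) would be a covering star.
  not-full : ∀ {s} → O s → ¬ (∀ v → v ∈ proj₁ s)
  not-full {s} Os full =
    avoids s s s Os Os Os (((s∈Sk , s∈Sk , s∈Sk) , covers) , star)
    where
    s∈Sk : InSk G k s
    s∈Sk = proj₁ orientation s Os
    covers : Covers G (s , s , s)
    covers = (λ v → inj₁ (full v)) , (λ u v _ → inj₁ (full u , full v))
    star : IsStar₃ (s , s , s)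
    star = pairwise-nested⇒star s s s (nested-refl s) (nested-refl s) (nested-refl s)

  Bad : Triple n → Set
  Bad (s₁ , s₂ , s₃) = (O s₁ × O s₂ × O s₃) × InF G k (s₁ , s₂ , s₃)

  LighterBad : Triple n → Set
  LighterBad t = ∃[ t′ ] (Bad t′ × weight₃ t′ < weight₃ t)

  Bad-swap₁₂ : (s₁ s₂ s₃ : OSep n) → Bad (s₁ , s₂ , s₃) → Bad (s₂ , s₁ , s₃)
  Bad-swap₁₂ s₁ s₂ s₃ ((O₁ , O₂ , O₃) , (k₁ , k₂ , k₃) , covers) =
    (O₂ , O₁ , O₃) , (k₂ , k₁ , k₃) , Covers-swap₁₂ G s₁ s₂ s₃ covers

  Bad-swap₂₃ : (s₁ s₂ s₃ : OSep n) → Bad (s₁ , s₂ , s₃) → Bad (s₁ , s₃ , s₂)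
  Bad-swap₂₃ s₁ s₂ s₃ ((O₁ , O₂ , O₃) , (k₁ , k₂ , k₃) , covers) =
    (O₁ , O₃ , O₂) , (k₁ , k₃ , k₂) , Covers-swap₂₃ G s₁ s₂ s₃ covers

  LighterBad-swap₁₂ : (s₁ s₂ s₃ : OSep n) → LighterBad (s₂ , s₁ , s₃) → LighterBad (s₁ , s₂ , s₃)
  LighterBad-swap₁₂ s₁ s₂ s₃ (t , bad , lighter) =
    t , bad , subst (weight₃ t <_) (x∙yz≈y∙xz (weight s₂) (weight s₁) (weight s₃)) lighter

  LighterBad-swap₂₃ : (s₁ s₂ s₃ : OSep n) → LighterBad (s₁ , s₃ , s₂) → LighterBad (s₁ , s₂ , s₃)
  LighterBad-swap₂₃ s₁ s₂ s₃ (t , bad , lighter) =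
    t , bad , subst (weight₃ t <_) (x∙yz≈x∙zy (weight s₁) (weight s₃) (weight s₂)) lighter

  replace-by-corner : (s₁ s₂ s₃ : OSep n) → Bad (s₁ , s₂ , s₃) → ¬ (s₁ ≤s inv s₂) →
    order (corner s₁ s₂) < k → LighterBad (s₁ , s₂ , s₃)
  replace-by-corner s₁ s₂ s₃ ((O₁ , O₂ , O₃) , (k₁ , k₂ , k₃) , covers) s₁≰s₂⃖ small =
    (r , s₂ , s₃) ,
    ((Or , O₂ , O₃) , (r∈Sk , k₂ , k₃) , corner-covers G s₁ s₂ s₃ (proj₁ k₂) covers) ,
    +-monoˡ-< (weight s₂ + weight s₃) lighter
    where
    r : OSep n
    r = corner s₁ s₂
    lighter : weight r < weight s₁
    lighter = corner-lighter s₁ s₂ s₁≰s₂⃖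
    r∈Sk : InSk G k r
    r∈Sk = corner-isSep G s₁ s₂ (proj₁ k₁) (proj₁ k₂) , small
    Or : O r
    Or = down-closed r∈Sk O₁ (corner-≤ s₁ s₂)
           (λ r≡s₁ → <-irrefl (cong weight r≡s₁) lighter)
           (not-full O₁ ∘ corner≡inv⇒full G s₁ s₂ (proj₁ k₁))

  -- Two non-nested members can be uncrossed: one of their two corners is in S_k.
  uncross : (s₁ s₂ s₃ : OSep n) → Bad (s₁ , s₂ , s₃) → ¬ Nested s₁ s₂ → LighterBad (s₁ , s₂ , s₃)
  uncross s₁ s₂ s₃ bad@(_ , (k₁ , k₂ , _) , _) ¬nested
    with corner-order< s₁ s₂ (proj₂ k₁) (proj₂ k₂)
  ... | inj₁ small = replace-by-corner s₁ s₂ s₃ bad (¬nested ∘ λ s₁≤s₂⃖ _ → s₁≤s₂⃖) small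
  ... | inj₂ small = LighterBad-swap₁₂ s₁ s₂ s₃
        (replace-by-corner s₂ s₁ s₃ (Bad-swap₁₂ s₁ s₂ s₃ bad)
          (¬nested ∘ λ s₂≤s₁⃖ _ → ≤inv-sym s₂ s₁ s₂≤s₁⃖) small)

  -- Every bad triple has a lighter one: it is not a star, so some pair of its
  -- members is not nested and can be uncrossed.
  bad⇒lighter : (t : Triple n) → Bad t → LighterBad t
  bad⇒lighter (s₁ , s₂ , s₃) bad@((O₁ , O₂ , O₃) , inF)
    with nested? s₁ s₂ | nested? s₁ s₃ | nested? s₂ s₃
  ... | yes n₁₂ | yes n₁₃ | yes n₂₃ =
    ⊥-elim (avoids s₁ s₂ s₃ O₁ O₂ O₃ (inF , pairwise-nested⇒star s₁ s₂ s₃ n₁₂ n₁₃ n₂₃))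
  ... | no ¬n₁₂ | _ | _ = uncross s₁ s₂ s₃ bad ¬n₁₂
  ... | yes _ | no ¬n₁₃ | _ =
    LighterBad-swap₂₃ s₁ s₂ s₃ (uncross s₁ s₃ s₂ (Bad-swap₂₃ s₁ s₂ s₃ bad) ¬n₁₃)
  ... | yes _ | yes _ | no ¬n₂₃ =
    LighterBad-swap₁₂ s₁ s₂ s₃ (LighterBad-swap₂₃ s₂ s₁ s₃
      (uncross s₂ s₃ s₁ (Bad-swap₂₃ s₂ s₁ s₃ (Bad-swap₁₂ s₁ s₂ s₃ bad)) ¬n₂₃))

  no-bad : (t : Triple n) → Acc _<_ (weight₃ t) → ¬ Bad t
  no-bad t (acc lighter-accessible) bad with bad⇒lighter t bad
  ... | t′ , bad′ , t′<t = no-bad t′ (lighter-accessible t′<t) bad′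

lemma5p2 : (n : ℕ) (G : Graph n) (k : ℕ) → k ≥ 1 →
    (O : OSep n → Set) → IsOrientation G k O → IsConsistent G k O →
    Avoids O (InFstar G k) → Avoids O (InF G k)
lemma5p2 n G k _ O orientation consistent avoids s₁ s₂ s₃ O₁ O₂ O₃ inF =
  Descent.no-bad G k O orientation consistent avoids
    (s₁ , s₂ , s₃) (<-wellFounded _) ((O₁ , O₂ , O₃) , inF)
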